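{- For $1\leq i\leq s$ let $d_i \geq 0$ be integers and $K_i = (\Delta_{2d_i+2})^{\leq d_i}$, and set $d = \dim(K_1*K_2*\cdots*K_s) = \left( \sum_{i=1}^s d_i \right)+s-1$. Then the $(d+1)$-graph whose vertices are the vertices of $K = K_1*K_2*\cdots*K_s$ and whose edges are the $d$-simplices of $K$ is $(d+1)$-partite if and only if $d_i = 0$ for all $1 \leq i \leq s$.
   Context: $\Delta_m^{\le j}$ is the complex of all subsets of size at most $j+1$ of an $(m+1)$-element set. The join $K_1*K_2$ has vertex set $V(K_1)\sqcup V(K_2)$ and simplices $F_1\sqcup F_2$ with $F_i\in K_i$. A $k$-graph $(V,E)$ (all edges of size $k$) is $k$-partite if $V$ can be partitioned into $k$ pairwise disjoint sets $V_1,\dots,V_k$ with $|S\cap V_j|\le1$ for all $j$ and all $S\in E$. -}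

module Defs where

open import Data.Nat using (ℕ; zero; suc; _+_; _*_; _≤_)
open import Data.Fin using (Fin)
import Data.Fin as F
open import Data.Fin.Subset using (Subset; _∈_; ∣_∣)
open import Data.Product using (Σ; _,_; _×_)
import Data.Product
open import Relation.Binary.PropositionalEquality using (_≡_)

sumFin : (s : ℕ) → (Fin s → ℕ) → ℕ
sumFin zero f = 0
sumFin (suc s) f = f F.zero + sumFin s (λ i → f (F.suc i))

record Hypergraph : Set₁ where
  field
    Vtx  : Set
    Edge : Set
    _∈ₑ_ : Vtx → Edge → Set

-- (V,E) is k-partite: V is partitioned into k pairwise disjoint sets V_1..V_k
-- (given by the part-assignment c : V → Fin k) such that |S ∩ V_j| ≤ 1 for
-- every edge S and every j, i.e. S ∩ V_j has at most one element.
IsPartite : ℕ → Hypergraph → Set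
IsPartite k H = Σ (Vtx → Fin k) λ c →
  (S : Edge) (j : Fin k) (v w : Vtx) →
    v ∈ₑ S → c v ≡ j → w ∈ₑ S → c w ≡ j → v ≡ w
  where open Hypergraph H

IsSimplexSkel : (m j : ℕ) → Subset (suc m) → Set
IsSimplexSkel m j σ = ∣ σ ∣ ≤ suc j

-- K_i = (Δ_{2 d_i + 2})^{≤ d_i}, with vertex set Fin (2 d_i + 3).
nV : ℕ → ℕ
nV di = suc (2 * di + 2)

JoinVtx : (s : ℕ) → (Fin s → ℕ) → Set
JoinVtx s d = Σ (Fin s) λ i → Fin (nV (d i))

record JoinSimplex (s : ℕ) (d : Fin s → ℕ) : Set where
  field
    part    : (i : Fin s) → Subset (nV (d i))
    isFace  : (i : Fin s) → IsSimplexSkel (2 * d i + 2) (d i) (part i)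

jsize : {s : ℕ} {d : Fin s → ℕ} → JoinSimplex s d → ℕ
jsize {s} σ = sumFin s (λ i → ∣ JoinSimplex.part σ i ∣)

_∈J_ : {s : ℕ} {d : Fin s → ℕ} → JoinVtx s d → JoinSimplex s d → Set
(i , x) ∈J σ = x ∈ JoinSimplex.part σ i

-- dimension d = (Σ d_i) + s - 1, so d + 1 = (Σ d_i) + s
dimPlusOne : (s : ℕ) → (Fin s → ℕ) → ℕ
dimPlusOne s d = sumFin s d + s

TopSimplex : (s : ℕ) → (Fin s → ℕ) → Set
TopSimplex s d = Σ (JoinSimplex s d) λ σ → jsize σ ≡ dimPlusOne s d

topGraph : (s : ℕ) → (Fin s → ℕ) → Hypergraph
topGraph s d = record
  { Vtx = JoinVtx s d
  ; Edge = TopSimplex s d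
  ; _∈ₑ_ = λ v S → v ∈J (Data.Product.proj₁ S)
  }

-- If every d i is 0, each K i is a set of three points and colouring a vertex of the join by
-- the factor it comes from is a proper colouring with s = d + 1 colours.
-- If some d i is positive, take the first d j + 1 vertices of every K j and one more vertex of
-- K i: these are d + 2 vertices, and any two of them lie in a common d-simplex (in every K j take
-- d j + 1 of its first d j + 2 vertices, in K i omitting one of the first three vertices that is
-- neither of the two), so two of them receive the same colour.
module Submission where

open import Defs
open import Data.Nat using (ℕ; zero; suc; _+_; _≤_; _<_; z≤n; s≤s; s≤s⁻¹; _≟_)
open import Data.Nat.Properties
  using (suc-injective; ≤-refl; ≤-trans; ≤-reflexive; <-≤-trans; <⇒≢; +-comm; +-suc; +-assoc; +-mono-≤; m≤m+n; n≤1+n; n≢0⇒n>0)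
open import Data.Fin using (Fin; toℕ; fromℕ<; inject≤; splitAt; _↑ˡ_; _↑ʳ_)
import Data.Fin as F
open import Data.Fin.Properties
  using (pigeonhole; toℕ-injective; toℕ-fromℕ<; toℕ-inject≤; splitAt⁻¹-↑ˡ; splitAt⁻¹-↑ʳ; toℕ<n)
  renaming (<⇒≢ to <⇒≢ᶠ)
open import Data.Fin.Subset using (Subset; _∈_; ∣_∣; _-_; ⁅_⁆; ⊥; inside; outside)
open import Data.Fin.Subset.Properties
  using (∣⊥∣≡0; ∣⁅x⁆∣≡1; x∈⁅y⁆⇒x≡y; p⊆q⇒∣p∣≤∣q∣; p─⊥≡p; x∈p∧x≢y⇒x∈p-y; x∈p⇒∣p-x∣<∣p∣)
open import Data.Vec using ([]; _∷_; here; there)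
open import Data.Product using (Σ; ∃; _,_; _×_; proj₁; proj₂; map₂)
open import Data.Sum using (inj₁; inj₂; [_,_]′)
open import Data.Empty using (⊥-elim)
open import Function using (_∘_)
open import Function.Bundles using (_⇔_; mk⇔)
open import Function.Definitions using (Injective)
open import Relation.Nullary using (¬_; yes; no; contradiction)
open import Relation.Nullary.Decidable using (decidable-stable)
open import Relation.Binary.PropositionalEquality using (_≡_; _≢_; refl; sym; trans; cong; cong₂; subst; module ≡-Reasoning)

private
  variable
    s n : ℕ

sumFin-cong : ∀ s {f g : Fin s → ℕ} → (∀ i → f i ≡ g i) → sumFin s f ≡ sumFin s g
sumFin-cong zero    f≡g = refl
sumFin-cong (suc s) f≡g = cong₂ _+_ (f≡g F.zero) (sumFin-cong s (f≡g ∘ F.suc))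

sumFin-suc : ∀ s (f : Fin s → ℕ) → sumFin s (suc ∘ f) ≡ sumFin s f + s
sumFin-suc zero    f = refl
sumFin-suc (suc s) f = begin
  suc (f F.zero + sumFin s (suc ∘ f ∘ F.suc)) ≡⟨ cong (λ m → suc (f F.zero + m)) (sumFin-suc s (f ∘ F.suc)) ⟩
  suc (f F.zero + (sumFin s (f ∘ F.suc) + s)) ≡⟨ cong suc (sym (+-assoc (f F.zero) _ s)) ⟩
  suc (sumFin (suc s) f + s)                 ≡⟨ sym (+-suc (sumFin (suc s) f) s) ⟩
  sumFin (suc s) f + suc s                   ∎
  where open ≡-Reasoning

sumFin-zero : ∀ s {f : Fin s → ℕ} → (∀ i → f i ≡ 0) → sumFin s f ≡ 0
sumFin-zero zero    f≡0 = refl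
sumFin-zero (suc s) f≡0 rewrite f≡0 F.zero = sumFin-zero s (f≡0 ∘ F.suc)

enumerate : ∀ s (k : Fin s → ℕ) → Fin (sumFin s k) → Σ (Fin s) (Fin ∘ k)
enumerate (suc s) k t =
  [ (F.zero ,_) , (λ u → F.suc (proj₁ u) , proj₂ u) ∘ enumerate s (k ∘ F.suc) ]′ (splitAt (k F.zero) t)

index : ∀ s (k : Fin s → ℕ) → Σ (Fin s) (Fin ∘ k) → Fin (sumFin s k)
index (suc s) k (F.zero  , x) = x ↑ˡ sumFin s (k ∘ F.suc)
index (suc s) k (F.suc j , x) = k F.zero ↑ʳ index s (k ∘ F.suc) (j , x)

index-enumerate : ∀ s (k : Fin s → ℕ) t → index s k (enumerate s k t) ≡ t
index-enumerate (suc s) k t with splitAt (k F.zero) t in eq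
... | inj₁ x = splitAt⁻¹-↑ˡ eq
... | inj₂ y = trans (cong (k F.zero ↑ʳ_) (index-enumerate s (k ∘ F.suc) y)) (splitAt⁻¹-↑ʳ eq)

enumerate-injective : ∀ s (k : Fin s → ℕ) → Injective _≡_ _≡_ (enumerate s k)
enumerate-injective s k {t} {t′} eq =
  trans (sym (index-enumerate s k t)) (trans (cong (index s k) eq) (index-enumerate s k t′))

level : {k : Fin s → ℕ} → Σ (Fin s) (Fin ∘ k) → ℕ
level (_ , x) = toℕ x

Σ-Fin-≡ : {k : Fin s → ℕ} {u v : Σ (Fin s) (Fin ∘ k)} → proj₁ u ≡ proj₁ v → level u ≡ level v → u ≡ v
Σ-Fin-≡ {u = j , x} {v = .j , y} refl x≡y = cong (j ,_) (toℕ-injective x≡y)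

x∈p⇒0<∣p∣ : {p : Subset n} {x : Fin n} → x ∈ p → 0 < ∣ p ∣
x∈p⇒0<∣p∣ {p = p} {x} x∈p = ≤-trans (≤-reflexive (sym (∣⁅x⁆∣≡1 x))) (p⊆q⇒∣p∣≤∣q∣ ⁅x⁆⊆p)
  where
  ⁅x⁆⊆p : ∀ {y} → y ∈ ⁅ x ⁆ → y ∈ p
  ⁅x⁆⊆p y∈⁅x⁆ = subst (_∈ p) (sym (x∈⁅y⁆⇒x≡y x y∈⁅x⁆)) x∈p

∣p∣≤1∧x∈p∧y∈p⇒x≡y : {p : Subset n} {x y : Fin n} → ∣ p ∣ ≤ 1 → x ∈ p → y ∈ p → x ≡ y
∣p∣≤1∧x∈p∧y∈p⇒x≡y {x = x} {y} ∣p∣≤1 x∈p y∈p with x F.≟ y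
... | yes x≡y = x≡y
... | no  x≢y = contradiction (≤-trans 0<∣p-x∣ ∣p-x∣≤0) λ ()
  where
  0<∣p-x∣ = x∈p⇒0<∣p∣ (x∈p∧x≢y⇒x∈p-y y∈p (x≢y ∘ sym))
  ∣p-x∣≤0 = s≤s⁻¹ (<-≤-trans (x∈p⇒∣p-x∣<∣p∣ x∈p) ∣p∣≤1)

x∈p⇒1+∣p-x∣≡∣p∣ : {p : Subset n} {x : Fin n} → x ∈ p → suc ∣ p - x ∣ ≡ ∣ p ∣
x∈p⇒1+∣p-x∣≡∣p∣ {p = inside ∷ p}  here        = cong (suc ∘ ∣_∣) (p─⊥≡p p)
x∈p⇒1+∣p-x∣≡∣p∣ {p = inside ∷ p}  (there x∈p) = cong suc (x∈p⇒1+∣p-x∣≡∣p∣ x∈p)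
x∈p⇒1+∣p-x∣≡∣p∣ {p = outside ∷ p} (there x∈p) = x∈p⇒1+∣p-x∣≡∣p∣ x∈p

initial : (n L : ℕ) → Subset n
initial zero    L       = []
initial (suc n) zero    = ⊥
initial (suc n) (suc L) = inside ∷ initial n L

∣initial∣ : ∀ n {L} → L ≤ n → ∣ initial n L ∣ ≡ L
∣initial∣ zero    z≤n     = refl
∣initial∣ (suc n) z≤n     = ∣⊥∣≡0 (suc n)
∣initial∣ (suc n) (s≤s L≤n) = cong suc (∣initial∣ n L≤n)

∈initial : ∀ {L} (x : Fin n) → toℕ x < L → x ∈ initial n L
∈initial {L = suc L} F.zero    _         = here
∈initial {L = suc L} (F.suc x) (s≤s x<L) = there (∈initial x x<L)

2+e≤nV : ∀ e → 2 + e ≤ nV e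
2+e≤nV e = s≤s (≤-trans (≤-reflexive (+-comm 1 e)) (+-mono-≤ (m≤m+n e (e + 0)) (n≤1+n 1)))

a≤1+e⇒a<nV : ∀ {e a} → a ≤ suc e → a < nV e
a≤1+e⇒a<nV {e} a≤1+e = <-≤-trans (s≤s a≤1+e) (2+e≤nV e)

faceWithout : ∀ e a → a ≤ suc e → Subset (nV e)
faceWithout e a a≤1+e = initial (nV e) (2 + e) - fromℕ< (a≤1+e⇒a<nV a≤1+e)

∣faceWithout∣ : ∀ e a (a≤1+e : a ≤ suc e) → ∣ faceWithout e a a≤1+e ∣ ≡ suc e
∣faceWithout∣ e a a≤1+e = suc-injective (trans (x∈p⇒1+∣p-x∣≡∣p∣ a∈initial) (∣initial∣ (nV e) (2+e≤nV e)))
  where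
  a∈initial = ∈initial _ (subst (_< 2 + e) (sym (toℕ-fromℕ< (a≤1+e⇒a<nV a≤1+e))) (s≤s a≤1+e))

∈faceWithout : ∀ e a (a≤1+e : a ≤ suc e) (y : Fin (nV e)) →
  toℕ y ≤ suc e → toℕ y ≢ a → y ∈ faceWithout e a a≤1+e
∈faceWithout e a a≤1+e y y≤1+e y≢a =
  x∈p∧x≢y⇒x∈p-y (∈initial y (s≤s y≤1+e)) (λ y≡a′ → y≢a (trans (cong toℕ y≡a′) (toℕ-fromℕ< _)))

topSimplexWithout : (d a : Fin s → ℕ) → (∀ j → a j ≤ suc (d j)) → TopSimplex s d
topSimplexWithout {s} d a a≤1+d =
  record { part = λ j → faceWithout (d j) (a j) (a≤1+d j)
         ; isFace = λ j → ≤-reflexive (∣faceWithout∣ (d j) (a j) (a≤1+d j)) }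
  , trans (sumFin-cong s λ j → ∣faceWithout∣ (d j) (a j) (a≤1+d j)) (sumFin-suc s d)

∈topSimplexWithout : (d a : Fin s → ℕ) (a≤1+d : ∀ j → a j ≤ suc (d j)) (v : JoinVtx s d) →
  level v ≤ suc (d (proj₁ v)) → level v ≢ a (proj₁ v) → v ∈J proj₁ (topSimplexWithout d a a≤1+d)
∈topSimplexWithout d a a≤1+d (j , y) = ∈faceWithout (d j) (a j) (a≤1+d j) y

below3-avoiding : ∀ m n → ∃ λ p → p < 3 × p ≢ m × p ≢ n
below3-avoiding (suc m)       (suc n)       = 0 , s≤s z≤n , (λ ()) , (λ ())
below3-avoiding zero          zero          = 1 , s≤s (s≤s z≤n) , (λ ()) , (λ ())
below3-avoiding zero          (suc zero)    = 2 , ≤-refl , (λ ()) , (λ ())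
below3-avoiding zero          (suc (suc n)) = 1 , s≤s (s≤s z≤n) , (λ ()) , (λ ())
below3-avoiding (suc zero)    zero          = 2 , ≤-refl , (λ ()) , (λ ())
below3-avoiding (suc (suc m)) zero          = 1 , s≤s (s≤s z≤n) , (λ ()) , (λ ())

PairwiseCovered : (H : Hypergraph) {m : ℕ} → (Fin m → Hypergraph.Vtx H) → Set
PairwiseCovered H g = ∀ a b → ∃ λ S → g a ∈ₑ S × g b ∈ₑ S
  where open Hypergraph H

pairwiseCovered⇒¬IsPartite : (H : Hypergraph) {k m : ℕ} → k < m → (g : Fin m → Hypergraph.Vtx H) →
  Injective _≡_ _≡_ g → PairwiseCovered H g → ¬ IsPartite k H
pairwiseCovered⇒¬IsPartite H k<m g g-injective covered (c , proper)
  with a , b , a<b , ca≡cb ← pigeonhole k<m (c ∘ g)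
  with S , ga∈S , gb∈S ← covered a b
  = <⇒≢ᶠ a<b (g-injective (proper S (c (g a)) (g a) (g b) ga∈S refl gb∈S (sym ca≡cb)))

module _ {s : ℕ} (d : Fin s → ℕ) (i : Fin s) (0<dᵢ : 0 < d i) where

  low : Σ (Fin s) (λ j → Fin (suc (d j))) → JoinVtx s d
  low = map₂ λ {j} x → inject≤ x (≤-trans (n≤1+n _) (2+e≤nV (d j)))

  level-low : ∀ u → level (low u) ≡ level u
  level-low (j , x) = toℕ-inject≤ x _

  low-injective : Injective _≡_ _≡_ low
  low-injective {u} {v} eq =
    Σ-Fin-≡ (cong proj₁ eq) (trans (sym (level-low u)) (trans (cong level eq) (level-low v)))

  vertex : Fin (suc (sumFin s (suc ∘ d))) → JoinVtx s d
  vertex F.zero    = i , fromℕ< (2+e≤nV (d i))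
  vertex (F.suc t) = low (enumerate s (suc ∘ d) t)

  vertex0≢low : ∀ u → vertex F.zero ≢ low u
  vertex0≢low (j , x) eq with refl ← cong proj₁ eq = <⇒≢ (toℕ<n x) (sym 1+dᵢ≡x)
    where
    1+dᵢ≡x : suc (d i) ≡ toℕ x
    1+dᵢ≡x = trans (sym (toℕ-fromℕ< (2+e≤nV (d i)))) (trans (cong level eq) (level-low (i , x)))

  vertex-injective : Injective _≡_ _≡_ vertex
  vertex-injective {F.zero}  {F.zero}   _  = refl
  vertex-injective {F.zero}  {F.suc t}  eq = ⊥-elim (vertex0≢low _ eq)
  vertex-injective {F.suc t} {F.zero}   eq = ⊥-elim (vertex0≢low _ (sym eq))
  vertex-injective {F.suc t} {F.suc t′} eq = cong F.suc (enumerate-injective s (suc ∘ d) (low-injective eq))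

  omitted : ℕ → Fin s → ℕ
  omitted p j with j F.≟ i
  ... | yes _ = p
  ... | no  _ = suc (d j)

  omitted≤ : ∀ {p} → p < 3 → ∀ j → omitted p j ≤ suc (d j)
  omitted≤ p<3 j with j F.≟ i
  ... | yes refl = ≤-trans (s≤s⁻¹ p<3) (s≤s 0<dᵢ)
  ... | no  _    = ≤-refl

  Admissible : JoinVtx s d → Set
  Admissible (j , y) = toℕ y ≤ suc (d j) × (j ≢ i → toℕ y ≤ d j)

  vertex-admissible : ∀ t → Admissible (vertex t)
  vertex-admissible F.zero    = ≤-reflexive (toℕ-fromℕ< (2+e≤nV (d i))) , λ i≢i → contradiction refl i≢i
  vertex-admissible (F.suc t) = ≤-trans x≤dⱼ (n≤1+n _) , λ _ → x≤dⱼ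
    where
    x≤dⱼ : level (vertex (F.suc t)) ≤ d (proj₁ (vertex (F.suc t)))
    x≤dⱼ = ≤-trans (≤-reflexive (level-low _)) (s≤s⁻¹ (toℕ<n (proj₂ (enumerate s (suc ∘ d) t))))

  admissible∈topSimplexWithout : ∀ {p} (p<3 : p < 3) v → Admissible v → level v ≢ p →
    v ∈J proj₁ (topSimplexWithout d (omitted p) (omitted≤ p<3))
  admissible∈topSimplexWithout {p} p<3 (j , y) (y≤1+dⱼ , y≤dⱼ) y≢p =
    ∈topSimplexWithout d (omitted p) (omitted≤ p<3) (j , y) y≤1+dⱼ y≢omitted
    where
    y≢omitted : toℕ y ≢ omitted p j
    y≢omitted with j F.≟ i
    ... | yes _   = y≢p
    ... | no j≢i = <⇒≢ (s≤s (y≤dⱼ j≢i))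

  vertices-pairwiseCovered : PairwiseCovered (topGraph s d) vertex
  vertices-pairwiseCovered a b
    with p , p<3 , p≢a , p≢b ← below3-avoiding (level (vertex a)) (level (vertex b))
    = topSimplexWithout d (omitted p) (omitted≤ p<3)
    , admissible∈topSimplexWithout p<3 (vertex a) (vertex-admissible a) (p≢a ∘ sym)
    , admissible∈topSimplexWithout p<3 (vertex b) (vertex-admissible b) (p≢b ∘ sym)

  ¬IsPartite-topGraph : ¬ IsPartite (dimPlusOne s d) (topGraph s d)
  ¬IsPartite-topGraph = pairwiseCovered⇒¬IsPartite (topGraph s d) (s≤s (≤-reflexive (sym (sumFin-suc s d))))
    vertex vertex-injective vertices-pairwiseCovered

blocks-IsPartite : (d : Fin s → ℕ) → (∀ j → d j ≡ 0) → IsPartite s (topGraph s d)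
blocks-IsPartite d d≡0 = proj₁ , proper
  where
  proper : ∀ S j v w → v ∈J proj₁ S → proj₁ v ≡ j → w ∈J proj₁ S → proj₁ w ≡ j → v ≡ w
  proper (σ , _) j (j , x) (j , y) x∈σ refl y∈σ refl =
    cong (j ,_) (∣p∣≤1∧x∈p∧y∈p⇒x≡y ∣σⱼ∣≤1 x∈σ y∈σ)
    where
    ∣σⱼ∣≤1 : ∣ JoinSimplex.part σ j ∣ ≤ 1
    ∣σⱼ∣≤1 = subst (λ e → ∣ JoinSimplex.part σ j ∣ ≤ suc e) (d≡0 j) (JoinSimplex.isFace σ j)

mainTheorem15 : (s : ℕ) → 1 ≤ s → (d : Fin s → ℕ) →
    IsPartite (dimPlusOne s d) (topGraph s d) ⇔ ((i : Fin s) → d i ≡ 0)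
mainTheorem15 s _ d = mk⇔
  (λ partite i → decidable-stable (d i ≟ 0) λ dᵢ≢0 → ¬IsPartite-topGraph d i (n≢0⇒n>0 dᵢ≢0) partite)
  (λ d≡0 → subst (λ m → IsPartite (m + s) (topGraph s d)) (sym (sumFin-zero s d≡0)) (blocks-IsPartite d d≡0))
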